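{- There is an absolute constant $C$ such that the following holds. Let $P$ be a length-$l$ width-5 branching program on $n$ input bits. Then, given $P$, one can construct a reversible circuit consisting of at most $C l$ Fredkin gates acting on $n+6$ bits (the $n$ input bits $x_1,\dots,x_n$, five ancilla bits $a_1,\dots,a_5$, and a sixth ancilla bit $e$) with the following properties: (i) for every $x\in\{0,1\}^n$ and every $a\in\{0,1\}^5$, if $e=1$ then the circuit permutes the values of the five ancilla bits $a_1,\dots,a_5$ according to the permutation $P(x)\in S_5$ output by the branching program on input $x$; (ii) for every one of the $2^{n+6}$ possible inputs, the value of the sixth ancilla bit $e$ is left unmodified by the circuit.
   Context: A length-$l$ width-5 branching program on $n$ input bits is a sequence of $l$ triples $(i_k,\alpha_k,\beta_k)$, $k=1,\dots,l$, with $i_k\in\{1,\dots,n\}$ and $\alpha_k,\beta_k\in S_5$. On input $x\in\{0,1\}^n$, the $k$-th triple contributes $\alpha_k$ if $x_{i_k}=0$ and $\beta_k$ if $x_{i_k}=1$; the output $P(x)\in S_5$ is the composition of these $l$ permutations taken in sequence order. "Permuting the five ancilla bits according to $\sigma\in S_5$" means moving the value in ancilla position $j$ to ancilla position $\sigma(j)$ for each $j$. A Fredkin gate acts on three specified distinct bits (a control bit and two target bits): if the control bit is 1 it swaps the two target bits, otherwise it does nothing; all other bits are unchanged. A reversible circuit is a finite sequence of such gates applied in order. -}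

module Defs where

open import Data.Nat using (ℕ)
open import Data.Bool using (Bool; true; false; if_then_else_)
open import Data.Fin using (Fin)
import Data.Fin as Fin
open import Data.Fin.Permutation using (Permutation′; _∘ₚ_; _⟨$⟩ʳ_)
import Data.Fin.Permutation as Perm
open import Data.Vec using (Vec; []; _∷_)
open import Data.List using (List; foldl)
open import Data.Product using (_×_; _,_)
open import Relation.Binary.PropositionalEquality using (_≡_; _≢_; refl; cong)
open import Relation.Nullary using (Dec; yes; no; does)

S₅ : Set
S₅ = Permutation′ 5

record Instr (n : ℕ) : Set where
  constructor instr
  field
    var : Fin n
    α   : S₅
    β   : S₅

BP : ℕ → ℕ → Set
BP n l = Vec (Instr n) l

contrib : ∀ {n} → Instr n → (Fin n → Bool) → S₅
contrib (instr i a b) x = if x i then b else a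

-- P(x): composition of the contributed permutations in sequence order:
-- the permutation of the first instruction is applied first
-- ((π ∘ₚ ρ) ⟨$⟩ʳ j = ρ ⟨$⟩ʳ (π ⟨$⟩ʳ j)).
evalBP : ∀ {n l} → BP n l → (Fin n → Bool) → S₅
evalBP []       x = Perm.id
evalBP (I ∷ Is) x = contrib I x ∘ₚ evalBP Is x

data Wire (n : ℕ) : Set where
  inp : Fin n → Wire n
  anc : Fin 5 → Wire n
  ext : Wire n

inp-injective : ∀ {n} {i j : Fin n} → inp i ≡ inp j → i ≡ j
inp-injective refl = refl

anc-injective : ∀ {n : ℕ} {i j : Fin 5} → anc {n} i ≡ anc j → i ≡ j
anc-injective refl = refl

_≟W_ : ∀ {n} (v w : Wire n) → Dec (v ≡ w)
_≟W_ {n} (inp i) (inp j) with Fin._≟_ {n} i j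
... | yes refl = yes refl
... | no ne    = no (λ eq → ne (inp-injective eq))
inp i ≟W anc j = no (λ ())
inp i ≟W ext   = no (λ ())
anc i ≟W inp j = no (λ ())
_≟W_ {n} (anc i) (anc j) with Fin._≟_ {5} i j
... | yes refl = yes refl
... | no ne    = no (λ eq → ne (anc-injective {n = n} eq))
anc i ≟W ext   = no (λ ())
ext   ≟W inp j = no (λ ())
ext   ≟W anc j = no (λ ())
ext   ≟W ext   = yes refl

State : ℕ → Set
State n = Wire n → Bool

record Fredkin (n : ℕ) : Set where
  constructor fredkin
  field
    control : Wire n
    target₁ : Wire n
    target₂ : Wire n
    c≢t₁    : control ≢ target₁
    c≢t₂    : control ≢ target₂
    t₁≢t₂   : target₁ ≢ target₂

applyGate : ∀ {n} → Fredkin n → State n → State n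
applyGate (fredkin c t₁ t₂ _ _ _) s w =
  if s c
  then (if does (w ≟W t₁) then s t₂
        else if does (w ≟W t₂) then s t₁
        else s w)
  else s w

Circuit : ℕ → Set
Circuit n = List (Fredkin n)

run : ∀ {n} → Circuit n → State n → State n
run C s = foldl (λ t g → applyGate g t) s C

initState : ∀ {n} → (Fin n → Bool) → (Fin 5 → Bool) → Bool → State n
initState x a b (inp i) = x i
initState x a b (anc j) = a j
initState x a b ext     = b

-- Each instruction (i, α, β) becomes two controlled permutations of the ancillas:
-- α controlled by e, followed by α⁻¹β controlled by xᵢ.  When e = 1 their product is
-- α if xᵢ = 0 and β if xᵢ = 1, i.e. the instruction's contribution.  A controlled
-- permutation of five wires is a product of at most five controlled transpositions,
-- and a controlled transposition of two ancillas is a single Fredkin gate; so C = 10.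
-- No gate ever targets e, hence e is never modified.
module Submission where

open import Defs
open import Data.Nat using (ℕ; zero; suc; _≤_; _*_; _+_; z≤n)
open import Data.Nat.Properties using (≤-refl; ≤-trans; ≤-reflexive; +-mono-≤; *-suc)
open import Data.Bool using (Bool; true; false; if_then_else_)
open import Data.Fin using (Fin; _≟_)
open import Data.Fin.Patterns using (0F)
open import Data.Fin.Permutation
  using (Permutation′; _≈_; _∘ₚ_; _⟨$⟩ʳ_; _⟨$⟩ˡ_; id; flip; inverseˡ; transpose; remove)
import Data.Fin.Permutation.Components as PC
open import Data.Fin.Permutation.Transposition.List
  using (TranspositionList; eval; decompose; eval-decompose)
open import Data.List using (List; []; _∷_; _++_; length)
open import Data.List.Properties using (foldl-++; length-++; length-map)
open import Data.Vec using ([]; _∷_)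
open import Data.Product using (Σ; _×_; _,_)
open import Function using (_∘_)
open import Relation.Binary.PropositionalEquality
  using (_≡_; _≢_; refl; sym; trans; cong; subst; module ≡-Reasoning)
open import Relation.Nullary using (yes; no; contradiction)
open import Relation.Nullary.Decidable using (dec-false)

open ≡-Reasoning

when : ∀ {m} → Bool → Permutation′ m → Permutation′ m
when b π = if b then π else id

when-cong : ∀ {m} b {π ρ : Permutation′ m} → π ≈ ρ → when b π ≈ when b ρ
when-cong true  π≈ρ = π≈ρ
when-cong false π≈ρ k = refl

when-id : ∀ {m} b → when {m} b id ≈ id
when-id true  k = refl
when-id false k = refl

when-∘ₚ : ∀ {m} b (π ρ : Permutation′ m) → when b π ∘ₚ when b ρ ≈ when b (π ∘ₚ ρ)
when-∘ₚ true  π ρ k = refl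
when-∘ₚ false π ρ k = refl

when-factor : ∀ {m} b (α β : Permutation′ m) → α ∘ₚ when b (flip α ∘ₚ β) ≈ (if b then β else α)
when-factor true  α β k = cong (β ⟨$⟩ʳ_) (inverseˡ α)
when-factor false α β k = refl

transpose-diagonal : ∀ {m} (i : Fin m) → transpose i i ≈ id
transpose-diagonal i k with k ≟ i
... | yes k≡i = sym k≡i
... | no k≢i  rewrite dec-false (k ≟ i) k≢i = refl

length-decompose : ∀ {m} (π : Permutation′ m) → length (decompose π) ≡ m
length-decompose {zero}  π = refl
length-decompose {suc m} π = cong suc (trans (length-map _ (decompose π′)) (length-decompose π′))
  where π′ = remove 0F (transpose 0F (π ⟨$⟩ˡ 0F) ∘ₚ π)

length-++-≤ : ∀ {A : Set} (xs ys : List A) {a b} →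
              length xs ≤ a → length ys ≤ b → length (xs ++ ys) ≤ a + b
length-++-≤ xs ys p q = ≤-trans (≤-reflexive (length-++ xs)) (+-mono-≤ p q)

module _ {n : ℕ} where

  NotAncilla : Wire n → Set
  NotAncilla w = ∀ j → w ≢ anc j

  inp-notAncilla : ∀ i → NotAncilla (inp i)
  inp-notAncilla i j ()

  ext-notAncilla : NotAncilla ext
  ext-notAncilla j ()

  PreservesNonAncillas : Circuit n → Set
  PreservesNonAncillas C = ∀ s w → NotAncilla w → run C s w ≡ s w

  PermutesAncillas : Circuit n → State n → S₅ → Set
  PermutesAncillas C s π = ∀ k → run C s (anc (π ⟨$⟩ʳ k)) ≡ s (anc k)

  run-++ : ∀ (A B : Circuit n) s w → run (A ++ B) s w ≡ run B (run A s) w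
  run-++ A B s w = cong (λ t → t w) (foldl-++ _ s A B)

  preserves-++ : ∀ A B → PreservesNonAncillas A → PreservesNonAncillas B →
                 PreservesNonAncillas (A ++ B)
  preserves-++ A B pA pB s w nw =
    trans (run-++ A B s w) (trans (pB (run A s) w nw) (pA s w nw))

  permutes-++ : ∀ A B s π ρ → PermutesAncillas A s π → PermutesAncillas B (run A s) ρ →
                PermutesAncillas (A ++ B) s (π ∘ₚ ρ)
  permutes-++ A B s π ρ pA pB k = begin
    run (A ++ B) s (anc (ρ ⟨$⟩ʳ (π ⟨$⟩ʳ k))) ≡⟨ run-++ A B s _ ⟩
    run B (run A s) (anc (ρ ⟨$⟩ʳ (π ⟨$⟩ʳ k))) ≡⟨ pB (π ⟨$⟩ʳ k) ⟩
    run A s (anc (π ⟨$⟩ʳ k))                  ≡⟨ pA k ⟩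
    s (anc k)                                 ∎

  permutes-cong : ∀ C s π ρ → π ≈ ρ → PermutesAncillas C s π → PermutesAncillas C s ρ
  permutes-cong C s π ρ π≈ρ p k = subst (λ j → run C s (anc j) ≡ s (anc k)) (π≈ρ k) (p k)

  record ControlledPerm (c : Wire n) (π : S₅) (C : Circuit n) : Set where
    field
      preserves : PreservesNonAncillas C
      permutes  : ∀ s → PermutesAncillas C s (when (s c) π)

  open ControlledPerm

  controlledPerm-[] : ∀ {c} → ControlledPerm c id []
  controlledPerm-[] {c} = record
    { preserves = λ _ _ _ → refl
    ; permutes  = λ s k → cong (s ∘ anc) (when-id (s c) k)
    }

  controlledPerm-cong : ∀ {c π ρ C} → π ≈ ρ → ControlledPerm c π C → ControlledPerm c ρ C
  controlledPerm-cong {c} {π} {ρ} {C} π≈ρ P = record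
    { preserves = preserves P
    ; permutes  = λ s →
        permutes-cong C s (when (s c) π) (when (s c) ρ) (when-cong (s c) π≈ρ) (permutes P s)
    }

  controlledPerm-∘ₚ : ∀ {c π ρ A B} → NotAncilla c →
                      ControlledPerm c π A → ControlledPerm c ρ B → ControlledPerm c (π ∘ₚ ρ) (A ++ B)
  controlledPerm-∘ₚ {c} {π} {ρ} {A} {B} c-notAnc PA PB = record
    { preserves = preserves-++ A B (preserves PA) (preserves PB)
    ; permutes  = λ s →
        permutes-cong (A ++ B) s (when (s c) π ∘ₚ when (s c) ρ) (when (s c) (π ∘ₚ ρ)) (when-∘ₚ (s c) π ρ)
          (permutes-++ A B s (when (s c) π) (when (s c) ρ) (permutes PA s) (pB s))
    }
    where
    pB : ∀ s → PermutesAncillas B (run A s) (when (s c) ρ)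
    pB s = subst (λ b → PermutesAncillas B (run A s) (when b ρ))
                 (preserves PA s c c-notAnc) (permutes PB (run A s))

  applyGate-idle : ∀ (g : Fredkin n) s w → s (Fredkin.control g) ≡ false → applyGate g s w ≡ s w
  applyGate-idle (fredkin c t₁ t₂ _ _ _) s w off rewrite off = refl

  applyGate-frame : ∀ (g : Fredkin n) s w →
                    w ≢ Fredkin.target₁ g → w ≢ Fredkin.target₂ g → applyGate g s w ≡ s w
  applyGate-frame (fredkin c t₁ t₂ _ _ _) s w w≢t₁ w≢t₂ with s c | w ≟W t₁ | w ≟W t₂
  ... | false | _         | _         = refl
  ... | true  | yes w≡t₁  | _         = contradiction w≡t₁ w≢t₁
  ... | true  | no _      | yes w≡t₂  = contradiction w≡t₂ w≢t₂
  ... | true  | no _      | no _      = refl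

  module _ (c : Wire n) (c-notAnc : NotAncilla c) where

    ancillaSwap : ∀ {i j} → i ≢ j → Fredkin n
    ancillaSwap {i} {j} i≢j =
      fredkin c (anc j) (anc i) (c-notAnc j) (c-notAnc i) (i≢j ∘ sym ∘ anc-injective)

    applyGate-ancillaSwap : ∀ {i j} (i≢j : i ≢ j) s m → s c ≡ true →
                            applyGate (ancillaSwap i≢j) s (anc m) ≡ s (anc (PC.transpose j i m))
    applyGate-ancillaSwap {i} {j} i≢j s m on rewrite on with m ≟ j
    ... | yes refl = refl
    ... | no _ with m ≟ i
    ...   | yes refl = refl
    ...   | no _     = refl

    controlledTranspose : Fin 5 → Fin 5 → Circuit n
    controlledTranspose i j with i ≟ j
    ... | yes _   = []
    ... | no  i≢j = ancillaSwap i≢j ∷ []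

    controlledPerm-ancillaSwap : ∀ {i j} (i≢j : i ≢ j) →
                                 ControlledPerm c (transpose i j) (ancillaSwap i≢j ∷ [])
    controlledPerm-ancillaSwap {i} {j} i≢j =
      record { preserves = swap-preserves ; permutes = swap-permutes }
      where
      swap-preserves : PreservesNonAncillas (ancillaSwap i≢j ∷ [])
      swap-preserves s w nw = applyGate-frame (ancillaSwap i≢j) s w (nw j) (nw i)

      swap-permutes : ∀ s → PermutesAncillas (ancillaSwap i≢j ∷ []) s (when (s c) (transpose i j))
      swap-permutes s = permutes-at (s c) refl
        where
        permutes-at : ∀ b → s c ≡ b → PermutesAncillas (ancillaSwap i≢j ∷ []) s (when b (transpose i j))
        permutes-at true  on  k = trans (applyGate-ancillaSwap i≢j s (PC.transpose i j k) on)
                                        (cong (s ∘ anc) (PC.transpose-inverse j i))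
        permutes-at false off k = applyGate-idle (ancillaSwap i≢j) s (anc k) off

    controlledPerm-transpose : ∀ i j → ControlledPerm c (transpose i j) (controlledTranspose i j)
    controlledPerm-transpose i j with i ≟ j
    ... | yes refl = controlledPerm-cong (λ k → sym (transpose-diagonal i k)) controlledPerm-[]
    ... | no  i≢j  = controlledPerm-ancillaSwap i≢j

    controlledTranspositions : TranspositionList 5 → Circuit n
    controlledTranspositions []             = []
    controlledTranspositions ((i , j) ∷ ts) = controlledTranspose i j ++ controlledTranspositions ts

    controlledPerm-eval : ∀ ts → ControlledPerm c (eval ts) (controlledTranspositions ts)
    controlledPerm-eval []             = controlledPerm-[]
    controlledPerm-eval ((i , j) ∷ ts) =
      controlledPerm-∘ₚ c-notAnc (controlledPerm-transpose i j) (controlledPerm-eval ts)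

    length-controlledTranspose : ∀ i j → length (controlledTranspose i j) ≤ 1
    length-controlledTranspose i j with i ≟ j
    ... | yes _ = z≤n
    ... | no  _ = ≤-refl

    length-controlledTranspositions : ∀ ts → length (controlledTranspositions ts) ≤ length ts
    length-controlledTranspositions []             = z≤n
    length-controlledTranspositions ((i , j) ∷ ts) =
      length-++-≤ (controlledTranspose i j) _
        (length-controlledTranspose i j) (length-controlledTranspositions ts)

    controlledPermutation : S₅ → Circuit n
    controlledPermutation π = controlledTranspositions (decompose π)

    controlledPerm-controlledPermutation : ∀ π → ControlledPerm c π (controlledPermutation π)
    controlledPerm-controlledPermutation π =
      controlledPerm-cong (eval-decompose π) (controlledPerm-eval (decompose π))

    length-controlledPermutation : ∀ π → length (controlledPermutation π) ≤ 5
    length-controlledPermutation π =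
      ≤-trans (length-controlledTranspositions (decompose π)) (≤-reflexive (length-decompose π))

  instructionCircuit : Instr n → Circuit n
  instructionCircuit (instr i α β) =
    controlledPermutation ext ext-notAncilla α
      ++ controlledPermutation (inp i) (inp-notAncilla i) (flip α ∘ₚ β)

  length-instructionCircuit : ∀ I → length (instructionCircuit I) ≤ 10
  length-instructionCircuit (instr i α β) =
    length-++-≤ (controlledPermutation ext ext-notAncilla α) _
      (length-controlledPermutation ext ext-notAncilla α)
      (length-controlledPermutation (inp i) (inp-notAncilla i) (flip α ∘ₚ β))

  preserves-instructionCircuit : ∀ I → PreservesNonAncillas (instructionCircuit I)
  preserves-instructionCircuit (instr i α β) =
    preserves-++ (controlledPermutation ext ext-notAncilla α) _
      (preserves (controlledPerm-controlledPermutation ext ext-notAncilla α))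
      (preserves (controlledPerm-controlledPermutation (inp i) (inp-notAncilla i) (flip α ∘ₚ β)))

  permutes-instructionCircuit : ∀ I x s → (∀ m → s (inp m) ≡ x m) → s ext ≡ true →
                                PermutesAncillas (instructionCircuit I) s (contrib I x)
  permutes-instructionCircuit (instr i α β) x s s-reads-x on =
    permutes-cong (A ++ B) s (α ∘ₚ when (x i) γ) (contrib (instr i α β) x) (when-factor (x i) α β)
      (permutes-++ A B s α (when (x i) γ) pA pB)
    where
    γ : S₅
    γ = flip α ∘ₚ β
    A B : Circuit n
    A = controlledPermutation ext ext-notAncilla α
    B = controlledPermutation (inp i) (inp-notAncilla i) γ
    PA : ControlledPerm ext α A
    PA = controlledPerm-controlledPermutation ext ext-notAncilla α
    PB : ControlledPerm (inp i) γ B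
    PB = controlledPerm-controlledPermutation (inp i) (inp-notAncilla i) γ

    pA : PermutesAncillas A s α
    pA = subst (λ b → PermutesAncillas A s (when b α)) on (permutes PA s)

    pB : PermutesAncillas B (run A s) (when (x i) γ)
    pB = subst (λ b → PermutesAncillas B (run A s) (when b γ))
               (trans (preserves PA s (inp i) (inp-notAncilla i)) (s-reads-x i))
               (permutes PB (run A s))

  programCircuit : ∀ {l} → BP n l → Circuit n
  programCircuit []      = []
  programCircuit (I ∷ P) = instructionCircuit I ++ programCircuit P

  length-programCircuit : ∀ {l} (P : BP n l) → length (programCircuit P) ≤ 10 * l
  length-programCircuit []                = z≤n
  length-programCircuit {suc l} (I ∷ P) =
    ≤-trans (length-++-≤ (instructionCircuit I) _
              (length-instructionCircuit I) (length-programCircuit P))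
            (≤-reflexive (sym (*-suc 10 l)))

  preserves-programCircuit : ∀ {l} (P : BP n l) → PreservesNonAncillas (programCircuit P)
  preserves-programCircuit []      s w nw = refl
  preserves-programCircuit (I ∷ P) =
    preserves-++ (instructionCircuit I) _ (preserves-instructionCircuit I) (preserves-programCircuit P)

  permutes-programCircuit : ∀ {l} (P : BP n l) x s → (∀ m → s (inp m) ≡ x m) → s ext ≡ true →
                            PermutesAncillas (programCircuit P) s (evalBP P x)
  permutes-programCircuit []      x s s-reads-x on k = refl
  permutes-programCircuit (I ∷ P) x s s-reads-x on =
    permutes-++ (instructionCircuit I) _ s (contrib I x) (evalBP P x)
      (permutes-instructionCircuit I x s s-reads-x on)
      (permutes-programCircuit P x s′ (λ m → trans (still (inp m) (inp-notAncilla m)) (s-reads-x m))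
                                      (trans (still ext ext-notAncilla) on))
    where
    s′ : State n
    s′ = run (instructionCircuit I) s
    still : ∀ w → NotAncilla w → s′ w ≡ s w
    still = preserves-instructionCircuit I s

lemma1 : Σ ℕ (λ C → (n l : ℕ) → (P : BP n l) → Σ (Circuit n) (λ circ →
           (length circ ≤ C * l)
           × ((x : Fin n → Bool) → (a : Fin 5 → Bool) → (j : Fin 5) →
                run circ (initState x a true) (anc (evalBP P x ⟨$⟩ʳ j)) ≡ a j)
           × ((s : State n) → run circ s ext ≡ s ext)))
lemma1 = 10 , λ n l P →
  programCircuit P ,
  length-programCircuit P ,
  (λ x a → permutes-programCircuit P x (initState x a true) (λ _ → refl) refl) ,
  (λ s → preserves-programCircuit P s ext ext-notAncilla)
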